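{- In ordered adjoint natural deduction with explicit structural rules: (1) If $\Gamma\vdash A_m\dashv\Omega$ then every labeled hypothesis of $\Omega$ belongs to $\Gamma$ and $\Omega\geq m$. (2) If $\Gamma\vdash A_m\dashv\Omega$ and $\Gamma'\supseteq\Gamma$ then $\Gamma'\vdash A_m\dashv\Omega$. (3) If $\Gamma_1\vdash A_m\dashv\Omega_A$ and $\Gamma_2,x{:}A_m\vdash C_r\dashv\Omega(x{:}A_m)^n$, and $|m|\sim n$, then $\Gamma_1\cup\Gamma_2\vdash C_r\dashv\Omega(\Omega_A)^n$. Here $\Omega(x{:}A_m)^n$ denotes an ordered context containing exactly $n$ occurrences of $x{:}A_m$ among its antecedents, and $\Omega(\Omega_A)^n$ is obtained by replacing each of those occurrences by the sequence $\Omega_A$.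
   Context: Modes and propositions. Fix a preorder $(\mathcal{M},\geq)$ of modes and, for each mode $m$, a set $\sigma(m)\subseteq\{\mathsf{W},\mathsf{C}^\leftarrow,\mathsf{C}^\rightarrow,\mathsf{M}^\leftarrow,\mathsf{M}^\rightarrow\}$ (weakening, left/right contraction, left/right mobility), monotone: $k\geq m$ implies $\sigma(k)\supseteq\sigma(m)$. Propositions: $A_m ::= P_m \mid A_m \rightarrowtail B_m \mid A_m \twoheadrightarrow B_m \mid A_m \,\&\, B_m \mid {\uparrow}^m_l A_l\ (m\geq l) \mid A_m\bullet B_m \mid 1_m \mid A_m\oplus B_m \mid {\downarrow}^k_m A_k\ (k\geq m)$. An ordered context $\Omega$ is a finite sequence of labeled hypotheses $x{:}A_m$ (repetitions allowed, each variable always labeling the same proposition); $|\Omega|$ is its set of variables; $\Omega\geq m$ means every $y{:}B_k$ in $\Omega$ has $k\geq m$. $|m|\sim n$ holds iff: $n=0$ and $\mathsf{W}\in\sigma(m)$; or $n=1$; or $n>1$ and ($\mathsf{C}^\leftarrow\in\sigma(m)$ or $\mathsf{C}^\rightarrow\in\sigma(m)$). Natural deduction with explicit structural rules: judgment $\Gamma\vdash A_m\dashv\Omega$ where $\Gamma$ is an unordered set of labeled hypotheses in scope and $\Omega$ the ordered context of hypotheses actually used. Rules (premises $\Rightarrow$ conclusion): (hyp) $x{:}A_m\in\Gamma\Rightarrow\Gamma\vdash A_m\dashv(x{:}A_m)$. ($1I$) $\Rightarrow\Gamma\vdash1_m\dashv\cdot$. ($1E$) $\Gamma\vdash1_m\dashv\Omega_M$,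 $m\geq r$, $\Gamma\vdash C_r\dashv\Omega_L\Omega_R\Rightarrow\Gamma\vdash C_r\dashv\Omega_L\Omega_M\Omega_R$. ($\bullet I$) $\Gamma\vdash A_m\dashv\Omega_L$, $\Gamma\vdash B_m\dashv\Omega_R\Rightarrow\Gamma\vdash A_m\bullet B_m\dashv\Omega_L\Omega_R$. ($\bullet E$) $\Gamma\vdash A_m\bullet B_m\dashv\Omega_M$, $m\geq r$, $x,y\notin|\Omega_L\Omega_R|$, $\Gamma,x{:}A_m,y{:}B_m\vdash C_r\dashv\Omega_L(x{:}A_m)(y{:}B_m)\Omega_R\Rightarrow\Gamma\vdash C_r\dashv\Omega_L\Omega_M\Omega_R$. ($\oplus I_i$) $\Gamma\vdash A_m\dashv\Omega$ (resp. $B_m$) $\Rightarrow\Gamma\vdash A_m\oplus B_m\dashv\Omega$. ($\oplus E$) $\Gamma\vdash A_m\oplus B_m\dashv\Omega_M$, $m\geq r$, $x\notin|\Omega_L\Omega_R|$, $\Gamma,x{:}A_m\vdash C_r\dashv\Omega_L(x{:}A_m)\Omega_R$, $\Gamma,x{:}B_m\vdash C_r\dashv\Omega_L(x{:}B_m)\Omega_R\Rightarrow\Gamma\vdash C_r\dashv\Omega_L\Omega_M\Omega_R$. (${\downarrow}I$) $\Gamma\vdash A_k\dashv\Omega\Rightarrow\Gamma\vdash{\downarrow}^k_mA_k\dashv\Omega$. (${\downarrow}E$) $\Gamma\vdash{\downarrow}^k_mA_k\dashv\Omega_M$, $m\geq r$, $\Gamma,x{:}A_k\vdash C_r\dashv\Omega_L(x{:}A_k)\Omega_R$,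 $x\notin|\Omega_L\Omega_R|\Rightarrow\Gamma\vdash C_r\dashv\Omega_L\Omega_M\Omega_R$. ($\twoheadrightarrow I$) $\Gamma,x{:}A_m\vdash B_m\dashv\Omega(x{:}A_m)$, $x\notin|\Omega|\Rightarrow\Gamma\vdash A_m\twoheadrightarrow B_m\dashv\Omega$. ($\twoheadrightarrow E$) $\Gamma\vdash A_m\twoheadrightarrow B_m\dashv\Omega_L$, $\Gamma\vdash A_m\dashv\Omega_R\Rightarrow\Gamma\vdash B_m\dashv\Omega_L\Omega_R$. ($\rightarrowtail I$) $\Gamma,x{:}A_m\vdash B_m\dashv(x{:}A_m)\Omega$, $x\notin|\Omega|\Rightarrow\Gamma\vdash A_m\rightarrowtail B_m\dashv\Omega$. ($\rightarrowtail E$) $\Gamma\vdash A_m\rightarrowtail B_m\dashv\Omega_R$, $\Gamma\vdash A_m\dashv\Omega_L\Rightarrow\Gamma\vdash B_m\dashv\Omega_L\Omega_R$. ($\& I$) $\Gamma\vdash A_m\dashv\Omega$, $\Gamma\vdash B_m\dashv\Omega\Rightarrow\Gamma\vdash A_m\&B_m\dashv\Omega$. ($\& E_i$) $\Gamma\vdash A_m\&B_m\dashv\Omega\Rightarrow\Gamma\vdash A_m\dashv\Omega$ (resp. $B_m$). (${\uparrow}I$) $\Gamma\vdash A_l\dashv\Omega$, $\Omega\geq m\Rightarrow\Gamma\vdash{\uparrow}^m_lA_l\dashv\Omega$. (${\uparrow}E$) $\Gamma\vdash{\uparrow}^l_kA_k\dashv\Omega\Rightarrow\Gamma\vdash A_k\dashv\Omega$.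 Structural rules: ($\mathsf{W}$) $\Gamma\vdash C_r\dashv\Omega_L\Omega_R$, $x{:}A_m\in\Gamma$, $m\geq r$, $\mathsf{W}\in\sigma(m)\Rightarrow\Gamma\vdash C_r\dashv\Omega_L(x{:}A_m)\Omega_R$. ($\mathsf{C}^\rightarrow$) $\Gamma\vdash C_r\dashv\Omega_L(x{:}A_m)\Omega_M(x{:}A_m)\Omega_R$, $\mathsf{C}^\rightarrow\in\sigma(m)\Rightarrow\Gamma\vdash C_r\dashv\Omega_L\Omega_M(x{:}A_m)\Omega_R$. ($\mathsf{C}^\leftarrow$) same premise, $\mathsf{C}^\leftarrow\in\sigma(m)\Rightarrow\Gamma\vdash C_r\dashv\Omega_L(x{:}A_m)\Omega_M\Omega_R$. ($\mathsf{M}^\rightarrow$) $\Gamma\vdash C_r\dashv\Omega_L(x{:}A_m)\Omega_M\Omega_R$, $\mathsf{M}^\rightarrow\in\sigma(m)\Rightarrow\Gamma\vdash C_r\dashv\Omega_L\Omega_M(x{:}A_m)\Omega_R$. ($\mathsf{M}^\leftarrow$) $\Gamma\vdash C_r\dashv\Omega_L\Omega_M(x{:}A_m)\Omega_R$, $\mathsf{M}^\leftarrow\in\sigma(m)\Rightarrow\Gamma\vdash C_r\dashv\Omega_L(x{:}A_m)\Omega_M\Omega_R$. -}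

module Defs where

open import Data.Nat using (ℕ; zero; suc)
open import Data.List using (List; []; _∷_; [_]; _++_)
open import Data.List.Membership.Propositional using (_∈_; _∉_)
open import Data.List.Relation.Unary.All using (All)
open import Data.Maybe using (Maybe; just; nothing)
open import Data.Product using (_×_)
open import Data.Sum using (_⊎_)
open import Data.Unit using (⊤)
open import Relation.Binary.PropositionalEquality using (_≢_)

-- Structural properties: weakening, left/right contraction, left/right mobility
data Struct : Set where
  W Cˡ Cʳ Mˡ Mʳ : Struct

record ModeSystem : Set₁ where
  field
    Mode     : Set
    _≥_      : Mode → Mode → Set
    ≥-refl   : ∀ {m} → m ≥ m
    ≥-trans  : ∀ {k l m} → k ≥ l → l ≥ m → k ≥ m
    _∈σ_     : Struct → Mode → Set
    σ-mono   : ∀ {k m s} → k ≥ m → s ∈σ m → s ∈σ k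

module Logic (MS : ModeSystem) (Atom : Set) where
  open ModeSystem MS

  infixr 6 _↣_ _↠_
  infixr 7 _&_ _•_ _⊕_

  data Prop : Mode → Set where
    atom : ∀ {m} → Atom → Prop m
    _↣_ _↠_ _&_ _•_ _⊕_ : ∀ {m} → Prop m → Prop m → Prop m
    𝟙    : ∀ {m} → Prop m
    ↑    : ∀ {m l} → m ≥ l → Prop l → Prop m
    ↓    : ∀ {k m} → k ≥ m → Prop k → Prop m

  -- A variable is intrinsically labeled by its
  -- proposition (the convention "each variable always labels the same
  -- proposition"), so a variable is identified with the labeled hypothesis.
  data Hyp : Set where
    _∶_ : ℕ → ∀ {m} → Prop m → Hyp

  modeOf : Hyp → Mode
  modeOf (_∶_ x {m} A) = m

  -- Ordered contexts; unordered contexts Γ are lists used only up to membership.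
  Ctx : Set
  Ctx = List Hyp

  _≽_ : Ctx → Mode → Set
  Ω ≽ m = All (λ h → modeOf h ≥ m) Ω

  _⊇_ : Ctx → Ctx → Set
  Γ' ⊇ Γ = ∀ {h} → h ∈ Γ → h ∈ Γ'

  _∼_ : Mode → ℕ → Set
  m ∼ zero          = W ∈σ m
  m ∼ suc zero      = ⊤
  m ∼ suc (suc _)   = Cˡ ∈σ m ⊎ Cʳ ∈σ m

  infix 4 _⊢_⊣_

  data _⊢_⊣_ (Γ : Ctx) : ∀ {m} → Prop m → Ctx → Set where
    hyp  : ∀ {m x} {A : Prop m} → (x ∶ A) ∈ Γ → Γ ⊢ A ⊣ [ x ∶ A ]
    𝟙I   : ∀ {m} → Γ ⊢ 𝟙 {m} ⊣ []
    𝟙E   : ∀ {m r} {C : Prop r} {ΩL ΩM ΩR} →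
           Γ ⊢ 𝟙 {m} ⊣ ΩM → m ≥ r → Γ ⊢ C ⊣ ΩL ++ ΩR →
           Γ ⊢ C ⊣ ΩL ++ ΩM ++ ΩR
    •I   : ∀ {m} {A B : Prop m} {ΩL ΩR} →
           Γ ⊢ A ⊣ ΩL → Γ ⊢ B ⊣ ΩR → Γ ⊢ A • B ⊣ ΩL ++ ΩR
    •E   : ∀ {m r} {A B : Prop m} {C : Prop r} {ΩL ΩM ΩR} x y →
           Γ ⊢ A • B ⊣ ΩM → m ≥ r →
           (x ∶ A) ∉ ΩL ++ ΩR → (y ∶ B) ∉ ΩL ++ ΩR →
           ((y ∶ B) ∷ (x ∶ A) ∷ Γ) ⊢ C ⊣ ΩL ++ (x ∶ A) ∷ (y ∶ B) ∷ ΩR →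
           Γ ⊢ C ⊣ ΩL ++ ΩM ++ ΩR
    ⊕I₁  : ∀ {m} {A B : Prop m} {Ω} → Γ ⊢ A ⊣ Ω → Γ ⊢ A ⊕ B ⊣ Ω
    ⊕I₂  : ∀ {m} {A B : Prop m} {Ω} → Γ ⊢ B ⊣ Ω → Γ ⊢ A ⊕ B ⊣ Ω
    ⊕E   : ∀ {m r} {A B : Prop m} {C : Prop r} {ΩL ΩM ΩR} x →
           Γ ⊢ A ⊕ B ⊣ ΩM → m ≥ r →
           (x ∶ A) ∉ ΩL ++ ΩR → (x ∶ B) ∉ ΩL ++ ΩR →
           ((x ∶ A) ∷ Γ) ⊢ C ⊣ ΩL ++ (x ∶ A) ∷ ΩR →
           ((x ∶ B) ∷ Γ) ⊢ C ⊣ ΩL ++ (x ∶ B) ∷ ΩR →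
           Γ ⊢ C ⊣ ΩL ++ ΩM ++ ΩR
    ↓I   : ∀ {k m} {p : k ≥ m} {A : Prop k} {Ω} →
           Γ ⊢ A ⊣ Ω → Γ ⊢ ↓ p A ⊣ Ω
    ↓E   : ∀ {k m r} {p : k ≥ m} {A : Prop k} {C : Prop r} {ΩL ΩM ΩR} x →
           Γ ⊢ ↓ p A ⊣ ΩM → m ≥ r →
           ((x ∶ A) ∷ Γ) ⊢ C ⊣ ΩL ++ (x ∶ A) ∷ ΩR →
           (x ∶ A) ∉ ΩL ++ ΩR →
           Γ ⊢ C ⊣ ΩL ++ ΩM ++ ΩR
    ↠I   : ∀ {m} {A B : Prop m} {Ω} x →
           ((x ∶ A) ∷ Γ) ⊢ B ⊣ Ω ++ [ x ∶ A ] → (x ∶ A) ∉ Ω →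
           Γ ⊢ A ↠ B ⊣ Ω
    ↠E   : ∀ {m} {A B : Prop m} {ΩL ΩR} →
           Γ ⊢ A ↠ B ⊣ ΩL → Γ ⊢ A ⊣ ΩR → Γ ⊢ B ⊣ ΩL ++ ΩR
    ↣I   : ∀ {m} {A B : Prop m} {Ω} x →
           ((x ∶ A) ∷ Γ) ⊢ B ⊣ (x ∶ A) ∷ Ω → (x ∶ A) ∉ Ω →
           Γ ⊢ A ↣ B ⊣ Ω
    ↣E   : ∀ {m} {A B : Prop m} {ΩL ΩR} →
           Γ ⊢ A ↣ B ⊣ ΩR → Γ ⊢ A ⊣ ΩL → Γ ⊢ B ⊣ ΩL ++ ΩR
    &I   : ∀ {m} {A B : Prop m} {Ω} →
           Γ ⊢ A ⊣ Ω → Γ ⊢ B ⊣ Ω → Γ ⊢ A & B ⊣ Ω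
    &E₁  : ∀ {m} {A B : Prop m} {Ω} → Γ ⊢ A & B ⊣ Ω → Γ ⊢ A ⊣ Ω
    &E₂  : ∀ {m} {A B : Prop m} {Ω} → Γ ⊢ A & B ⊣ Ω → Γ ⊢ B ⊣ Ω
    ↑I   : ∀ {m l} {p : m ≥ l} {A : Prop l} {Ω} →
           Γ ⊢ A ⊣ Ω → Ω ≽ m → Γ ⊢ ↑ p A ⊣ Ω
    ↑E   : ∀ {l k} {p : l ≥ k} {A : Prop k} {Ω} →
           Γ ⊢ ↑ p A ⊣ Ω → Γ ⊢ A ⊣ Ω
    wk   : ∀ {r m} {C : Prop r} {A : Prop m} {ΩL ΩR} x →
           Γ ⊢ C ⊣ ΩL ++ ΩR → (x ∶ A) ∈ Γ → m ≥ r → W ∈σ m →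
           Γ ⊢ C ⊣ ΩL ++ (x ∶ A) ∷ ΩR
    contrʳ : ∀ {r m} {C : Prop r} {A : Prop m} {ΩL ΩM ΩR} x →
           Γ ⊢ C ⊣ ΩL ++ (x ∶ A) ∷ ΩM ++ (x ∶ A) ∷ ΩR → Cʳ ∈σ m →
           Γ ⊢ C ⊣ ΩL ++ ΩM ++ (x ∶ A) ∷ ΩR
    contrˡ : ∀ {r m} {C : Prop r} {A : Prop m} {ΩL ΩM ΩR} x →
           Γ ⊢ C ⊣ ΩL ++ (x ∶ A) ∷ ΩM ++ (x ∶ A) ∷ ΩR → Cˡ ∈σ m →
           Γ ⊢ C ⊣ ΩL ++ (x ∶ A) ∷ ΩM ++ ΩR
    mobʳ : ∀ {r m} {C : Prop r} {A : Prop m} {ΩL ΩM ΩR} x →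
           Γ ⊢ C ⊣ ΩL ++ (x ∶ A) ∷ ΩM ++ ΩR → Mʳ ∈σ m →
           Γ ⊢ C ⊣ ΩL ++ ΩM ++ (x ∶ A) ∷ ΩR
    mobˡ : ∀ {r m} {C : Prop r} {A : Prop m} {ΩL ΩM ΩR} x →
           Γ ⊢ C ⊣ ΩL ++ ΩM ++ (x ∶ A) ∷ ΩR → Mˡ ∈σ m →
           Γ ⊢ C ⊣ ΩL ++ (x ∶ A) ∷ ΩM ++ ΩR

  -- Ordered contexts with holes: Ω(x:A)^n is  plug F [ x ∶ A ]  where F has
  -- n holes (nothing) and no other occurrence of x:A;
  -- Ω(Ω_A)^n is  plug F Ω_A.
  Frame : Set
  Frame = List (Maybe Hyp)

  plug : Frame → Ctx → Ctx
  plug []              Δ = []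
  plug (nothing ∷ F)   Δ = Δ ++ plug F Δ
  plug (just h ∷ F)    Δ = h ∷ plug F Δ

  holes : Frame → ℕ
  holes []            = zero
  holes (nothing ∷ F) = suc (holes F)
  holes (just _ ∷ F)  = holes F

  Avoids : Frame → Hyp → Set
  Avoids F h = All (λ e → e ≢ just h) F

-- Part (3) is an instance of simultaneous substitution: a derivation of C from Ω
-- remains a derivation after each hypothesis of Ω is replaced by a derivation of it,
-- the used context becoming the concatenation of the contexts those derivations use.
-- A structural rule acting on one hypothesis becomes the same rule applied to every
-- hypothesis of the block replacing it; this is admissible because, by (1), every
-- hypothesis used in a derivation of B_k has mode ≥ k and so inherits σ(k).
module Submission where

open import Defs
open import Data.List using (List; []; _∷_; [_]; _++_; map)
open import Data.List.Membership.Propositional using (_∈_; _∉_)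
open import Data.List.Membership.Propositional.Properties using (∈-++⁻; ∈-map⁺)
open import Data.List.Properties using (++-assoc; ++-identityʳ)
open import Data.List.Relation.Binary.Permutation.Propositional using (↭-sym)
open import Data.List.Relation.Binary.Permutation.Propositional.Properties
  using (∈-resp-↭; shift; shifts)
import Data.List.Relation.Binary.Permutation.Propositional.Properties as ↭
open import Data.List.Relation.Binary.Subset.Propositional using (_⊆_)
open import Data.List.Relation.Binary.Subset.Propositional.Properties
  using (⊆-reflexive-↭; xs⊆x∷xs; xs⊆xs++ys; xs⊆ys++xs; ∷⁺ʳ; ++⁺ʳ)
open import Data.List.Relation.Unary.All as All using (All; []; _∷_)
open import Data.List.Relation.Unary.All.Properties using (++⁺)
open import Data.List.Relation.Unary.Any using (here; there)
open import Data.List.Extrema.Nat using (max; xs≤max)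
open import Data.Maybe using (just; nothing)
open import Data.Nat using (ℕ; suc)
open import Data.Nat.Properties using (n≮n)
open import Data.Product using (_×_; _,_; proj₁; proj₂)
open import Data.Sum using (_⊎_; inj₁; inj₂)
open import Relation.Nullary using (contradiction)
open import Relation.Binary.PropositionalEquality using (_≡_; refl; sym; trans; cong; subst)

∈-++-middle⁻ : ∀ {A : Set} (xs ys : List A) {zs v} →
               v ∈ xs ++ ys ++ zs → v ∈ ys ⊎ v ∈ xs ++ zs
∈-++-middle⁻ xs ys p = ∈-++⁻ ys (∈-resp-↭ (shifts xs ys) p)

⊆-insert : ∀ {A : Set} (xs ys : List A) {zs} → xs ++ zs ⊆ xs ++ ys ++ zs
⊆-insert xs ys = ++⁺ʳ xs (xs⊆ys++xs _ ys)

∈-∷-fresh⁻ : ∀ {A : Set} {a v : A} {xs ys} → v ∈ a ∷ xs → v ∈ ys → a ∉ ys → v ∈ xs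
∈-∷-fresh⁻ (here refl) v∈ys a∉ys = contradiction v∈ys a∉ys
∈-∷-fresh⁻ (there v∈xs) _ _ = v∈xs

module Metatheory (MS : ModeSystem) (Atom : Set) where
  open ModeSystem MS
  open Logic MS Atom

  cast : ∀ {Γ Ω Ω' m} {C : Prop m} → Ω ≡ Ω' → Γ ⊢ C ⊣ Ω → Γ ⊢ C ⊣ Ω'
  cast {Γ} {C = C} = subst (Γ ⊢ C ⊣_)

  Available : Ctx → Mode → Hyp → Set
  Available Γ m h = h ∈ Γ × modeOf h ≥ m

  lower : ∀ {Γ m r h} → m ≥ r → Available Γ m h → Available Γ r h
  lower m≥r (h∈Γ , h≥m) = h∈Γ , ≥-trans h≥m m≥r

  unbind : ∀ {Γ Ω m a h} → Available (a ∷ Γ) m h → h ∈ Ω → a ∉ Ω → Available Γ m h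
  unbind (h∈aΓ , h≥m) h∈Ω a∉Ω = ∈-∷-fresh⁻ h∈aΓ h∈Ω a∉Ω , h≥m

  used⇒available : ∀ {Γ Ω m} {A : Prop m} → Γ ⊢ A ⊣ Ω → ∀ {h} → h ∈ Ω → Available Γ m h
  used⇒available (hyp x∈Γ) (here refl) = x∈Γ , ≥-refl
  used⇒available (𝟙E {ΩL = ΩL} {ΩM} d q e) p with ∈-++-middle⁻ ΩL ΩM p
  ... | inj₁ u = lower q (used⇒available d u)
  ... | inj₂ u = used⇒available e u
  used⇒available (•I {ΩL = ΩL} d e) p with ∈-++⁻ ΩL p
  ... | inj₁ u = used⇒available d u
  ... | inj₂ u = used⇒available e u
  used⇒available (•E {ΩL = ΩL} {ΩM} _ _ d q x∉ y∉ e) p with ∈-++-middle⁻ ΩL ΩM p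
  ... | inj₁ u = lower q (used⇒available d u)
  ... | inj₂ u = unbind (unbind (used⇒available e (⊆-insert ΩL (_ ∷ _ ∷ []) u)) u y∉) u x∉
  used⇒available (⊕I₁ d) p = used⇒available d p
  used⇒available (⊕I₂ d) p = used⇒available d p
  used⇒available (⊕E {ΩL = ΩL} {ΩM} _ d q x∉ _ e _) p with ∈-++-middle⁻ ΩL ΩM p
  ... | inj₁ u = lower q (used⇒available d u)
  ... | inj₂ u = unbind (used⇒available e (⊆-insert ΩL [ _ ] u)) u x∉
  used⇒available (↓I {p = k≥m} d) p = lower k≥m (used⇒available d p)
  used⇒available (↓E {ΩL = ΩL} {ΩM} _ d q e x∉) p with ∈-++-middle⁻ ΩL ΩM p
  ... | inj₁ u = lower q (used⇒available d u)
  ... | inj₂ u = unbind (used⇒available e (⊆-insert ΩL [ _ ] u)) u x∉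
  used⇒available (↠I _ d x∉) p = unbind (used⇒available d (xs⊆xs++ys _ _ p)) p x∉
  used⇒available (↠E {ΩL = ΩL} d e) p with ∈-++⁻ ΩL p
  ... | inj₁ u = used⇒available d u
  ... | inj₂ u = used⇒available e u
  used⇒available (↣I _ d x∉) p = unbind (used⇒available d (there p)) p x∉
  used⇒available (↣E {ΩL = ΩL} d e) p with ∈-++⁻ ΩL p
  ... | inj₁ u = used⇒available e u
  ... | inj₂ u = used⇒available d u
  used⇒available (&I d _) p = used⇒available d p
  used⇒available (&E₁ d) p = used⇒available d p
  used⇒available (&E₂ d) p = used⇒available d p
  used⇒available (↑I d Ω≽m) p = proj₁ (used⇒available d p) , All.lookup Ω≽m p
  used⇒available (↑E {p = l≥k} d) p = lower l≥k (used⇒available d p)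
  used⇒available (wk {ΩL = ΩL} _ d x∈Γ q _) p with ∈-++-middle⁻ ΩL [ _ ] p
  ... | inj₁ (here refl) = x∈Γ , q
  ... | inj₂ u = used⇒available d u
  used⇒available (contrʳ {ΩL = ΩL} _ d _) p =
    used⇒available d (++⁺ʳ ΩL (xs⊆x∷xs _ _) p)
  used⇒available (contrˡ {ΩL = ΩL} {ΩM} _ d _) p =
    used⇒available d (++⁺ʳ ΩL (∷⁺ʳ _ (⊆-insert ΩM [ _ ])) p)
  used⇒available (mobʳ {ΩL = ΩL} {ΩM} {ΩR} _ d _) p =
    used⇒available d (⊆-reflexive-↭ (↭.++⁺ˡ ΩL (shift _ ΩM ΩR)) p)
  used⇒available (mobˡ {ΩL = ΩL} {ΩM} {ΩR} _ d _) p =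
    used⇒available d (⊆-reflexive-↭ (↭.++⁺ˡ ΩL (↭-sym (shift _ ΩM ΩR))) p)

  used-available : ∀ {Γ Ω m} {A : Prop m} → Γ ⊢ A ⊣ Ω → All (Available Γ m) Ω
  used-available d = All.tabulate (used⇒available d)

  used-σ : ∀ {Γ Ω m s} {A : Prop m} → Γ ⊢ A ⊣ Ω → s ∈σ m → All (λ h → s ∈σ modeOf h) Ω
  used-σ d s∈σm = All.tabulate (λ p → σ-mono (proj₂ (used⇒available d p)) s∈σm)

  weaken : ∀ {Γ Γ' Ω m} {A : Prop m} → Γ ⊢ A ⊣ Ω → Γ ⊆ Γ' → Γ' ⊢ A ⊣ Ω
  weaken (hyp x∈Γ) f = hyp (f x∈Γ)
  weaken 𝟙I f = 𝟙I
  weaken (𝟙E {ΩL = ΩL} {ΩR = ΩR} d q e) f = 𝟙E {ΩL = ΩL} {ΩR = ΩR} (weaken d f) q (weaken e f)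
  weaken (•I d e) f = •I (weaken d f) (weaken e f)
  weaken (•E x y d q x∉ y∉ e) f = •E x y (weaken d f) q x∉ y∉ (weaken e (∷⁺ʳ _ (∷⁺ʳ _ f)))
  weaken (⊕I₁ d) f = ⊕I₁ (weaken d f)
  weaken (⊕I₂ d) f = ⊕I₂ (weaken d f)
  weaken (⊕E x d q x∉ x∉′ e e′) f =
    ⊕E x (weaken d f) q x∉ x∉′ (weaken e (∷⁺ʳ _ f)) (weaken e′ (∷⁺ʳ _ f))
  weaken (↓I d) f = ↓I (weaken d f)
  weaken (↓E x d q e x∉) f = ↓E x (weaken d f) q (weaken e (∷⁺ʳ _ f)) x∉
  weaken (↠I x d x∉) f = ↠I x (weaken d (∷⁺ʳ _ f)) x∉
  weaken (↠E d e) f = ↠E (weaken d f) (weaken e f)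
  weaken (↣I x d x∉) f = ↣I x (weaken d (∷⁺ʳ _ f)) x∉
  weaken (↣E d e) f = ↣E (weaken d f) (weaken e f)
  weaken (&I d e) f = &I (weaken d f) (weaken e f)
  weaken (&E₁ d) f = &E₁ (weaken d f)
  weaken (&E₂ d) f = &E₂ (weaken d f)
  weaken (↑I d Ω≽m) f = ↑I (weaken d f) Ω≽m
  weaken (↑E d) f = ↑E (weaken d f)
  weaken (wk x d x∈Γ q w) f = wk x (weaken d f) (f x∈Γ) q w
  weaken (contrʳ x d c) f = contrʳ x (weaken d f) c
  weaken (contrˡ x d c) f = contrˡ x (weaken d f) c
  weaken (mobʳ x d c) f = mobʳ x (weaken d f) c
  weaken (mobˡ x d c) f = mobˡ x (weaken d f) c

  name : Hyp → ℕ
  name (x ∶ _) = x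

  fresh : Ctx → ℕ
  fresh Ω = suc (max 0 (map name Ω))

  fresh-∉ : ∀ Ω {m} {B : Prop m} → (fresh Ω ∶ B) ∉ Ω
  fresh-∉ Ω p = n≮n _ (All.lookup (xs≤max 0 (map name Ω)) (∈-map⁺ name p))

  wk* : ∀ {Γ r} {C : Prop r} ΩL Θ {ΩR} → Γ ⊢ C ⊣ ΩL ++ ΩR →
        All (λ h → Available Γ r h × W ∈σ modeOf h) Θ → Γ ⊢ C ⊣ ΩL ++ Θ ++ ΩR
  wk* ΩL [] d [] = d
  wk* ΩL ((x ∶ _) ∷ Θ) d (((x∈Γ , q) , w) ∷ ws) = wk {ΩL = ΩL} x (wk* ΩL Θ d ws) x∈Γ q w

  contrʳ* : ∀ {Γ r} {C : Prop r} ΩL Θ ΩM {ΩR} → Γ ⊢ C ⊣ ΩL ++ Θ ++ ΩM ++ Θ ++ ΩR →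
            All (λ h → Cʳ ∈σ modeOf h) Θ → Γ ⊢ C ⊣ ΩL ++ ΩM ++ Θ ++ ΩR
  contrʳ* ΩL [] ΩM d [] = d
  contrʳ* ΩL (t@(x ∶ _) ∷ Θ) ΩM {ΩR} d (c ∷ cs) =
    cast (cong (ΩL ++_) (++-assoc ΩM [ t ] _))
      (contrʳ* ΩL Θ (ΩM ++ [ t ])
        (cast (cong (ΩL ++_) (reassoc Θ ΩM))
          (contrʳ {ΩL = ΩL} {ΩM = Θ ++ ΩM} x
            (cast (cong (λ Ω → ΩL ++ t ∷ Ω) (sym (++-assoc Θ ΩM _))) d) c))
        cs)
    where
    reassoc : ∀ Ξ ΩM {Y} → (Ξ ++ ΩM) ++ t ∷ Y ≡ Ξ ++ (ΩM ++ [ t ]) ++ Y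
    reassoc Ξ ΩM = trans (++-assoc Ξ ΩM _) (cong (Ξ ++_) (sym (++-assoc ΩM [ t ] _)))

  contrˡ* : ∀ {Γ r} {C : Prop r} ΩL Θ ΩM {ΩR} → Γ ⊢ C ⊣ ΩL ++ Θ ++ ΩM ++ Θ ++ ΩR →
            All (λ h → Cˡ ∈σ modeOf h) Θ → Γ ⊢ C ⊣ ΩL ++ Θ ++ ΩM ++ ΩR
  contrˡ* ΩL [] ΩM d [] = d
  contrˡ* ΩL (t@(x ∶ _) ∷ Θ) ΩM {ΩR} d (c ∷ cs) =
    cast (++-assoc ΩL [ t ] _)
      (contrˡ* (ΩL ++ [ t ]) Θ ΩM
        (cast (sym (++-assoc ΩL [ t ] _))
          (cast (cong (λ Ω → ΩL ++ t ∷ Ω) (++-assoc Θ ΩM _))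
            (contrˡ {ΩL = ΩL} {ΩM = Θ ++ ΩM} x
              (cast (cong (λ Ω → ΩL ++ t ∷ Ω) (sym (++-assoc Θ ΩM _))) d) c)))
        cs)

  mobʳ* : ∀ {Γ r} {C : Prop r} ΩL Θ ΩM {ΩR} → Γ ⊢ C ⊣ ΩL ++ Θ ++ ΩM ++ ΩR →
          All (λ h → Mʳ ∈σ modeOf h) Θ → Γ ⊢ C ⊣ ΩL ++ ΩM ++ Θ ++ ΩR
  mobʳ* ΩL [] ΩM d [] = d
  mobʳ* ΩL (t@(x ∶ _) ∷ Θ) ΩM d (c ∷ cs) =
    mobʳ {ΩL = ΩL} {ΩM = ΩM} x
      (cast (++-assoc ΩL [ t ] _)
        (mobʳ* (ΩL ++ [ t ]) Θ ΩM (cast (sym (++-assoc ΩL [ t ] _)) d) cs))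
      c

  mobˡ* : ∀ {Γ r} {C : Prop r} ΩL Θ ΩM {ΩR} → Γ ⊢ C ⊣ ΩL ++ ΩM ++ Θ ++ ΩR →
          All (λ h → Mˡ ∈σ modeOf h) Θ → Γ ⊢ C ⊣ ΩL ++ Θ ++ ΩM ++ ΩR
  mobˡ* ΩL [] ΩM d [] = d
  mobˡ* ΩL (t@(x ∶ _) ∷ Θ) ΩM d (c ∷ cs) =
    cast (++-assoc ΩL [ t ] _)
      (mobˡ* (ΩL ++ [ t ]) Θ ΩM
        (cast (sym (++-assoc ΩL [ t ] _)) (mobˡ {ΩL = ΩL} {ΩM = ΩM} x d c))
        cs)

  infix 4 _⊢*_⊣_
  data _⊢*_⊣_ (Γ : Ctx) : Ctx → Ctx → Set where
    []  : Γ ⊢* [] ⊣ []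
    _∷_ : ∀ {m x} {B : Prop m} {ΘB Ω Θ} →
          Γ ⊢ B ⊣ ΘB → Γ ⊢* Ω ⊣ Θ → Γ ⊢* (x ∶ B) ∷ Ω ⊣ ΘB ++ Θ

  data Split (Γ : Ctx) (Ω₁ Ω₂ : Ctx) : Ctx → Set where
    split : ∀ {Θ₁ Θ₂} → Γ ⊢* Ω₁ ⊣ Θ₁ → Γ ⊢* Ω₂ ⊣ Θ₂ → Split Γ Ω₁ Ω₂ (Θ₁ ++ Θ₂)

  ⊢*-++⁻ : ∀ {Γ} Ω₁ {Ω₂ Θ} → Γ ⊢* Ω₁ ++ Ω₂ ⊣ Θ → Split Γ Ω₁ Ω₂ Θ
  ⊢*-++⁻ [] σ = split [] σ
  ⊢*-++⁻ (_ ∷ Ω₁) (_∷_ {ΘB = ΘB} d σ) with ⊢*-++⁻ Ω₁ σ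
  ... | split {Θ₁} {Θ₂} σ₁ σ₂ = subst (Split _ _ _) (++-assoc ΘB Θ₁ Θ₂) (split (d ∷ σ₁) σ₂)

  ⊢*-++⁺ : ∀ {Γ Ω₁ Ω₂ Θ₁ Θ₂} → Γ ⊢* Ω₁ ⊣ Θ₁ → Γ ⊢* Ω₂ ⊣ Θ₂ → Γ ⊢* Ω₁ ++ Ω₂ ⊣ Θ₁ ++ Θ₂
  ⊢*-++⁺ [] τ = τ
  ⊢*-++⁺ {Θ₂ = Θ₂} (_∷_ {ΘB = ΘB} {Θ = Θ} d σ) τ =
    subst (_ ⊢* _ ⊣_) (sym (++-assoc ΘB Θ Θ₂)) (d ∷ ⊢*-++⁺ σ τ)

  ⊢*-weaken : ∀ {Γ Γ' Ω Θ} → Γ ⊢* Ω ⊣ Θ → Γ ⊆ Γ' → Γ' ⊢* Ω ⊣ Θ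
  ⊢*-weaken [] f = []
  ⊢*-weaken (d ∷ σ) f = weaken d f ∷ ⊢*-weaken σ f

  ⊢*-≽ : ∀ {Γ Ω Θ m} → Γ ⊢* Ω ⊣ Θ → Ω ≽ m → Θ ≽ m
  ⊢*-≽ [] [] = []
  ⊢*-≽ (d ∷ σ) (k≥m ∷ Ω≽m) =
    ++⁺ (All.map (λ a → proj₂ (lower k≥m a)) (used-available d)) (⊢*-≽ σ Ω≽m)

  ⊢*-around : ∀ {Γ Γ' ΩL Ξ ΩR ΘL Ξ' ΘR} → Γ ⊆ Γ' →
              Γ ⊢* ΩL ⊣ ΘL → Γ' ⊢* Ξ ⊣ Ξ' → Γ ⊢* ΩR ⊣ ΘR →
              Γ' ⊢* ΩL ++ Ξ ++ ΩR ⊣ ΘL ++ Ξ' ++ ΘR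
  ⊢*-around f σL τ σR = ⊢*-++⁺ (⊢*-weaken σL f) (⊢*-++⁺ τ (⊢*-weaken σR f))

  substitute : ∀ {Δ Γ Ω Θ r} {C : Prop r} → Δ ⊢ C ⊣ Ω → Γ ⊢* Ω ⊣ Θ → Γ ⊢ C ⊣ Θ
  substitute (hyp _) (d ∷ []) = cast (sym (++-identityʳ _)) d
  substitute 𝟙I [] = 𝟙I
  substitute (𝟙E {ΩL = ΩL} {ΩM} d q e) σ with ⊢*-++⁻ ΩL σ
  ... | split σL σMR with ⊢*-++⁻ ΩM σMR
  ... | split {Θ₂ = ΘR} σM σR =
    𝟙E {ΩR = ΘR} (substitute d σM) q (substitute e (⊢*-++⁺ σL σR))
  substitute (•I {ΩL = ΩL} d e) σ with ⊢*-++⁻ ΩL σ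
  ... | split σL σR = •I (substitute d σL) (substitute e σR)
  substitute (•E {ΩL = ΩL} {ΩM} _ _ d q _ _ e) σ with ⊢*-++⁻ ΩL σ
  ... | split {ΘL} σL σMR with ⊢*-++⁻ ΩM σMR
  ... | split {Θ₂ = ΘR} σM σR =
    •E z z (substitute d σM) q (fresh-∉ (ΘL ++ ΘR)) (fresh-∉ (ΘL ++ ΘR))
      (substitute e (⊢*-around (λ p → there (there p)) σL
        (hyp (there (here refl)) ∷ hyp (here refl) ∷ []) σR))
    where
    -- one name suffices for both bound hypotheses: they are told apart by their propositions,
    -- and if A and B coincide so do the two hypotheses
    z = fresh (ΘL ++ ΘR)
  substitute (⊕I₁ d) σ = ⊕I₁ (substitute d σ)
  substitute (⊕I₂ d) σ = ⊕I₂ (substitute d σ)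
  substitute (⊕E {ΩL = ΩL} {ΩM} _ d q _ _ e e′) σ with ⊢*-++⁻ ΩL σ
  ... | split {ΘL} σL σMR with ⊢*-++⁻ ΩM σMR
  ... | split {Θ₂ = ΘR} σM σR =
    ⊕E z (substitute d σM) q (fresh-∉ (ΘL ++ ΘR)) (fresh-∉ (ΘL ++ ΘR))
      (substitute e (⊢*-around there σL (hyp (here refl) ∷ []) σR))
      (substitute e′ (⊢*-around there σL (hyp (here refl) ∷ []) σR))
    where z = fresh (ΘL ++ ΘR)
  substitute (↓I d) σ = ↓I (substitute d σ)
  substitute (↓E {ΩL = ΩL} {ΩM} _ d q e _) σ with ⊢*-++⁻ ΩL σ
  ... | split {ΘL} σL σMR with ⊢*-++⁻ ΩM σMR
  ... | split {Θ₂ = ΘR} σM σR =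
    ↓E (fresh (ΘL ++ ΘR)) (substitute d σM) q
      (substitute e (⊢*-around there σL (hyp (here refl) ∷ []) σR))
      (fresh-∉ (ΘL ++ ΘR))
  substitute {Θ = Θ} (↠I _ d _) σ =
    ↠I (fresh Θ) (substitute d (⊢*-++⁺ (⊢*-weaken σ there) (hyp (here refl) ∷ [])))
      (fresh-∉ Θ)
  substitute (↠E {ΩL = ΩL} d e) σ with ⊢*-++⁻ ΩL σ
  ... | split σL σR = ↠E (substitute d σL) (substitute e σR)
  substitute {Θ = Θ} (↣I _ d _) σ =
    ↣I (fresh Θ) (substitute d (hyp (here refl) ∷ ⊢*-weaken σ there)) (fresh-∉ Θ)
  substitute (↣E {ΩL = ΩL} d e) σ with ⊢*-++⁻ ΩL σ
  ... | split σL σR = ↣E (substitute d σR) (substitute e σL)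
  substitute (&I d e) σ = &I (substitute d σ) (substitute e σ)
  substitute (&E₁ d) σ = &E₁ (substitute d σ)
  substitute (&E₂ d) σ = &E₂ (substitute d σ)
  substitute (↑I d Ω≽m) σ = ↑I (substitute d σ) (⊢*-≽ σ Ω≽m)
  substitute (↑E d) σ = ↑E (substitute d σ)
  substitute (wk {ΩL = ΩL} _ d _ q w) σ with ⊢*-++⁻ ΩL σ
  ... | split {ΘL} σL (_∷_ {ΘB = Θx} dx σR) =
    wk* ΘL Θx (substitute d (⊢*-++⁺ σL σR))
      (All.zipWith (λ (a , w′) → lower q a , w′) (used-available dx , used-σ dx w))
  substitute (contrʳ {ΩL = ΩL} {ΩM} _ d c) σ with ⊢*-++⁻ ΩL σ
  ... | split {ΘL} σL σMR with ⊢*-++⁻ ΩM σMR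
  ... | split {ΘM} σM (_∷_ {ΘB = Θx} dx σR) =
    contrʳ* ΘL Θx ΘM (substitute d (⊢*-++⁺ σL (dx ∷ ⊢*-++⁺ σM (dx ∷ σR)))) (used-σ dx c)
  substitute (contrˡ {ΩL = ΩL} {ΩM} _ d c) σ with ⊢*-++⁻ ΩL σ
  ... | split {ΘL} σL (_∷_ {ΘB = Θx} dx σMR) with ⊢*-++⁻ ΩM σMR
  ... | split {ΘM} σM σR =
    contrˡ* ΘL Θx ΘM (substitute d (⊢*-++⁺ σL (dx ∷ ⊢*-++⁺ σM (dx ∷ σR)))) (used-σ dx c)
  substitute (mobʳ {ΩL = ΩL} {ΩM} _ d c) σ with ⊢*-++⁻ ΩL σ
  ... | split {ΘL} σL σMR with ⊢*-++⁻ ΩM σMR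
  ... | split {ΘM} σM (_∷_ {ΘB = Θx} dx σR) =
    mobʳ* ΘL Θx ΘM (substitute d (⊢*-++⁺ σL (dx ∷ ⊢*-++⁺ σM σR))) (used-σ dx c)
  substitute (mobˡ {ΩL = ΩL} {ΩM} _ d c) σ with ⊢*-++⁻ ΩL σ
  ... | split {ΘL} σL (_∷_ {ΘB = Θx} dx σMR) with ⊢*-++⁻ ΩM σMR
  ... | split {ΘM} σM σR =
    mobˡ* ΘL Θx ΘM (substitute d (⊢*-++⁺ σL (⊢*-++⁺ σM (dx ∷ σR)))) (used-σ dx c)

  plug-⊢* : ∀ {Γ ΩA m x} {A : Prop m} (F : Frame) → Γ ⊢ A ⊣ ΩA → Avoids F (x ∶ A) →
            plug F [ x ∶ A ] ⊆ (x ∶ A) ∷ Γ → Γ ⊢* plug F [ x ∶ A ] ⊣ plug F ΩA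
  plug-⊢* [] dA _ _ = []
  plug-⊢* (nothing ∷ F) dA (_ ∷ av) f = dA ∷ plug-⊢* F dA av (λ p → f (there p))
  plug-⊢* (just (_ ∶ _) ∷ F) dA (≢x ∷ av) f with f (here refl)
  ... | here refl = contradiction refl ≢x
  ... | there h∈Γ = hyp h∈Γ ∷ plug-⊢* F dA av (λ p → f (there p))

  substitution : ∀ {Γ₁ Γ₂ ΩA m r} {A : Prop m} {C : Prop r} x (F : Frame) →
                 Γ₁ ⊢ A ⊣ ΩA → ((x ∶ A) ∷ Γ₂) ⊢ C ⊣ plug F [ x ∶ A ] → Avoids F (x ∶ A) →
                 (Γ₁ ++ Γ₂) ⊢ C ⊣ plug F ΩA
  substitution {Γ₁} x F dA dC av =
    substitute dC (plug-⊢* F (weaken dA (xs⊆xs++ys _ _)) av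
      (λ p → ∷⁺ʳ _ (xs⊆ys++xs _ Γ₁) (proj₁ (used⇒available dC p))))

lemma1 : (MS : ModeSystem) (Atom : Set) →
    let open ModeSystem MS
        open Logic MS Atom
    in
    (∀ {Γ Ω m} {A : Prop m} → Γ ⊢ A ⊣ Ω → All (λ h → h ∈ Γ) Ω × Ω ≽ m)
    ×
    (∀ {Γ Γ' Ω m} {A : Prop m} → Γ ⊢ A ⊣ Ω → Γ' ⊇ Γ → Γ' ⊢ A ⊣ Ω)
    ×
    (∀ {Γ₁ Γ₂ ΩA m r} {A : Prop m} {C : Prop r} (x : ℕ) (F : Frame) →
       Γ₁ ⊢ A ⊣ ΩA →
       ((x ∶ A) ∷ Γ₂) ⊢ C ⊣ plug F [ x ∶ A ] →
       Avoids F (x ∶ A) →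
       m ∼ holes F →
       (Γ₁ ++ Γ₂) ⊢ C ⊣ plug F ΩA)
lemma1 MS Atom =
  (λ d → All.map proj₁ (used-available d) , All.map proj₂ (used-available d)) ,
  weaken ,
  (λ x F dA dC av _ → substitution x F dA dC av)
  where open Metatheory MS Atom
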